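{- Let $n>4$ be an integer and let $N=\lceil\sqrt{n}\,\rceil$. If $N\nmid (n-1)$ and $N\nmid \left(n-1+\left\lfloor\frac{n-1}{N}\right\rfloor\right)$, then $O\chi(C_n)=N$.
   Context: $C_n$ denotes the cycle graph on $n$ vertices. All colourings are proper vertex colourings. Two colourings $c_1,c_2$ of a graph are orthogonal if whenever two distinct vertices receive the same colour in one colouring, they receive distinct colours in the other (equivalently, no colour pair $(c_1(v),c_2(v))$ occurs at two distinct vertices). An orthogonal colouring is a pair of orthogonal proper colourings; $O\chi(G)$, the orthogonal chromatic number, is the minimum number of colours needed for an orthogonal colouring of $G$ (both colourings drawing from the same set of that many colours). -}

module Defs where

open import Data.Nat using (ℕ; zero; suc; _∸_; _*_; _<_; _≤_)
open import Data.Fin using (Fin; toℕ)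
open import Data.Product using (_×_; _,_; Σ)
open import Data.Sum using (_⊎_)
open import Relation.Binary.PropositionalEquality using (_≡_; _≢_)
open import Function.Definitions using (Injective)

CycleStep : (n : ℕ) → Fin n → Fin n → Set
CycleStep n i j = (toℕ j ≡ suc (toℕ i)) ⊎ ((suc (toℕ i) ≡ n) × (toℕ j ≡ 0))

CycleAdj : (n : ℕ) → Fin n → Fin n → Set
CycleAdj n i j = CycleStep n i j ⊎ CycleStep n j i

ProperColouring : (n k : ℕ) → (Fin n → Fin k) → Set
ProperColouring n k c = ∀ i j → CycleAdj n i j → c i ≢ c j

Orthogonal : (n k : ℕ) → (Fin n → Fin k) → (Fin n → Fin k) → Set
Orthogonal n k c₁ c₂ = Injective _≡_ _≡_ (λ v → (c₁ v , c₂ v))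

HasOrthColouring : (n k : ℕ) → Set
HasOrthColouring n k =
  Σ (Fin n → Fin k) λ c₁ → Σ (Fin n → Fin k) λ c₂ →
    ProperColouring n k c₁ × ProperColouring n k c₂ × Orthogonal n k c₁ c₂

OrthChromaticNumberIs : (n N : ℕ) → Set
OrthChromaticNumberIs n N =
  HasOrthColouring n N × (∀ k → k < N → HasOrthColouring n k → Data.Empty.⊥)
  where import Data.Empty

-- N = ⌈√n⌉ : the unique N with (N-1)² < n ≤ N² (for n ≥ 1).
IsCeilSqrt : ℕ → ℕ → Set
IsCeilSqrt n N = ((N ∸ 1) * (N ∸ 1) < n) × (n ≤ N * N)

-- Lay the vertices 0, …, n-1 of C_n row by row into an N × N grid, i = q N + r with r < N.
-- Colour vertex i by its column r and by the diagonal (r + q) mod N. Along the cycle one of the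
-- colours moves by 1 and the other by 1 or 2 modulo N, so both are proper as soon as N > 2 and
-- the closing edge {n-1, 0} is not monochromatic, which is what the two divisibility hypotheses
-- say. As q < N, column and diagonal determine (r, q), hence i, so the colourings are orthogonal.
-- Conversely, k colours give at most k² colour pairs, while n > (N-1)² vertices need distinct ones.
module Submission where

open import Defs
open import Data.Nat using (ℕ; _<_; _+_; _∸_; NonZero)
open import Data.Nat.DivMod using (_/_)
open import Data.Nat.Divisibility using (_∤_)

open import Data.Nat using (suc; _*_; _%_; _≤_; s≤s; z<s; >-nonZero; >-nonZero⁻¹)
open import Data.Nat.Properties
open import Data.Nat.DivMod
  using (_mod_; m≡m%n+[m/n]*n; m%n<n; %-distribˡ-+; m<n⇒m%n≡m; /-monoˡ-≤; +-distrib-/-∣ʳ;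
         n/n≡1; m<n*o⇒m/o<n; 0/n≡0)
open import Data.Nat.Divisibility using (_∣_; divides; ∣-refl; ∣⇒≤)
open import Data.Fin using (Fin; toℕ; combine)
open import Data.Fin.Properties using (toℕ<n; toℕ-fromℕ<; toℕ-injective; combine-injective; injective⇒≤)
open import Data.Product using (_,_; proj₁; proj₂)
open import Data.Sum using (_⊎_; inj₁; inj₂)
open import Data.Empty using (⊥)
open import Function using (_∘_)
open import Relation.Nullary using (contradiction)
open import Relation.Binary using (tri<; tri≈; tri>)
open import Relation.Binary.PropositionalEquality

%≡%⇒∣∸ : ∀ m n d .{{_ : NonZero d}} → m % d ≡ n % d → d ∣ m ∸ n
%≡%⇒∣∸ m n d m%d≡n%d = divides (m / d ∸ n / d) (begin
  m ∸ n                                     ≡⟨ cong₂ _∸_ (m≡m%n+[m/n]*n m d) (m≡m%n+[m/n]*n n d) ⟩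
  (m % d + m / d * d) ∸ (n % d + n / d * d) ≡⟨ cong (λ r → (m % d + m / d * d) ∸ (r + n / d * d)) m%d≡n%d ⟨
  (m % d + m / d * d) ∸ (m % d + n / d * d) ≡⟨ [m+n]∸[m+o]≡n∸o (m % d) (m / d * d) (n / d * d) ⟩
  m / d * d ∸ n / d * d                     ≡⟨ *-distribʳ-∸ d (m / d) (n / d) ⟨
  (m / d ∸ n / d) * d                       ∎)
  where open ≡-Reasoning

∤⇒%≢0% : ∀ m d .{{_ : NonZero d}} → d ∤ m → m % d ≢ 0 % d
∤⇒%≢0% m d d∤m = d∤m ∘ %≡%⇒∣∸ m 0 d

%-shift-≢ : ∀ s m d .{{_ : NonZero d}} → 0 < s → s < d → (s + m) % d ≢ m % d
%-shift-≢ s m d 0<s s<d eq = <⇒≱ s<d (∣⇒≤ {{>-nonZero 0<s}} d∣s)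
  where
  d∣s : d ∣ s
  d∣s = subst (d ∣_) (m+n∸n≡m s m) (%≡%⇒∣∸ (s + m) m d eq)

%-shift-<-≢ : ∀ m {a b d} .{{_ : NonZero d}} → a < b → b < d → (m + a) % d ≢ (m + b) % d
%-shift-<-≢ m {a} {b} {d} a<b b<d eq =
  %-shift-≢ (b ∸ a) (m + a) d (m<n⇒0<n∸m a<b) (≤-<-trans (m∸n≤m b a) b<d)
    (trans (cong (_% d) shifted) (sym eq))
  where
  open ≡-Reasoning
  shifted : b ∸ a + (m + a) ≡ m + b
  shifted = begin
    b ∸ a + (m + a) ≡⟨ cong (b ∸ a +_) (+-comm m a) ⟩
    b ∸ a + (a + m) ≡⟨ +-assoc (b ∸ a) a m ⟨
    b ∸ a + a + m   ≡⟨ cong (_+ m) (m∸n+n≡m (<⇒≤ a<b)) ⟩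
    b + m           ≡⟨ +-comm b m ⟩
    m + b           ∎

%-cancelˡ-< : ∀ m {a b d} .{{_ : NonZero d}} → a < d → b < d →
              (m + a) % d ≡ (m + b) % d → a ≡ b
%-cancelˡ-< m {a} {b} a<d b<d eq with <-cmp a b
... | tri< a<b _ _ = contradiction eq (%-shift-<-≢ m a<b b<d)
... | tri≈ _ a≡b _ = a≡b
... | tri> _ _ b<a = contradiction (sym eq) (%-shift-<-≢ m b<a a<d)

%-/-injective : ∀ m n d .{{_ : NonZero d}} → m % d ≡ n % d → m / d ≡ n / d → m ≡ n
%-/-injective m n d %≡ /≡ = begin
  m                 ≡⟨ m≡m%n+[m/n]*n m d ⟩
  m % d + m / d * d ≡⟨ cong₂ (λ r q → r + q * d) %≡ /≡ ⟩
  n % d + n / d * d ≡⟨ m≡m%n+[m/n]*n n d ⟨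
  n                 ∎
  where open ≡-Reasoning

mod≡⇒%≡ : ∀ m n d .{{_ : NonZero d}} → m mod d ≡ n mod d → m % d ≡ n % d
mod≡⇒%≡ m n d eq =
  trans (sym (toℕ-fromℕ< (m%n<n m d))) (trans (cong toℕ eq) (toℕ-fromℕ< (m%n<n n d)))

suc-/ : ∀ m d .{{_ : NonZero d}} → suc m / d ≡ m / d ⊎ suc m / d ≡ suc (m / d)
suc-/ m d with m≤n⇒m<n∨m≡n (/-monoˡ-≤ d (n≤1+n m))
... | inj₁ m/d<1+m/d = inj₂ (≤-antisym upper m/d<1+m/d)
  where
  open ≤-Reasoning
  upper : suc m / d ≤ suc (m / d)
  upper = begin
    suc m / d     ≤⟨ /-monoˡ-≤ d (subst (_≤ m + d) (+-comm m 1) (+-monoʳ-≤ m (>-nonZero⁻¹ d))) ⟩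
    (m + d) / d   ≡⟨ +-distrib-/-∣ʳ m ∣-refl ⟩
    m / d + d / d ≡⟨ cong (m / d +_) (n/n≡1 d) ⟩
    m / d + 1     ≡⟨ +-comm (m / d) 1 ⟩
    suc (m / d)   ∎
... | inj₂ m/d≡1+m/d = inj₁ (sym m/d≡1+m/d)

sequence⇒properColouring : ∀ {n k} (c : ℕ → Fin k) → (∀ i → c (suc i) ≢ c i) →
                           c (n ∸ 1) ≢ c 0 → ProperColouring n k (c ∘ toℕ)
sequence⇒properColouring {n} c step wrap i j (inj₁ i→j) = noStep i j i→j
  where
  noStep : ∀ i j → CycleStep n i j → c (toℕ i) ≢ c (toℕ j)
  noStep i j (inj₁ j≡1+i) eq = step (toℕ i) (trans (cong c (sym j≡1+i)) (sym eq))
  noStep i j (inj₂ (1+i≡n , j≡0)) eq =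
    wrap (trans (cong (λ m → c (m ∸ 1)) (sym 1+i≡n)) (trans eq (cong c j≡0)))
sequence⇒properColouring c step wrap i j (inj₂ j→i) =
  sequence⇒properColouring c step wrap j i (inj₁ j→i) ∘ sym

orthogonal⇒≤² : ∀ {n k c₁ c₂} → Orthogonal n k c₁ c₂ → n ≤ k * k
orthogonal⇒≤² {c₁ = c₁} {c₂} orth = injective⇒≤ {f = λ v → combine (c₁ v) (c₂ v)} λ eq →
  let c₁≡ , c₂≡ = combine-injective _ _ _ _ eq in orth (cong₂ _,_ c₁≡ c₂≡)

¬orthColouring-<ceilSqrt : ∀ {n N k} → IsCeilSqrt n N → k < N → HasOrthColouring n k → ⊥
¬orthColouring-<ceilSqrt {N = N} {k} (n>[N-1]² , _) k<N (_ , _ , _ , _ , orth) =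
  <⇒≱ (≤-<-trans (*-mono-≤ k≤N-1 k≤N-1) n>[N-1]²) (orthogonal⇒≤² orth)
  where
  k≤N-1 : k ≤ N ∸ 1
  k≤N-1 = ∸-monoˡ-≤ 1 k<N

module GridColouring (N : ℕ) .{{_ : NonZero N}} where

  diagonal : ℕ → ℕ
  diagonal i = i + i / N

  columnColour diagonalColour : ℕ → Fin N
  columnColour i = i mod N
  diagonalColour i = diagonal i mod N

  columnColour-step : 1 < N → ∀ i → columnColour (suc i) ≢ columnColour i
  columnColour-step 1<N i = %-shift-≢ 1 i N z<s 1<N ∘ mod≡⇒%≡ (suc i) i N

  diagonalColour-step : 2 < N → ∀ i → diagonalColour (suc i) ≢ diagonalColour i
  diagonalColour-step 2<N i eq with suc-/ i N | mod≡⇒%≡ (diagonal (suc i)) (diagonal i) N eq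
  ... | inj₁ same  | eq% rewrite same = %-shift-≢ 1 (diagonal i) N z<s (<-trans (s≤s z<s) 2<N) eq%
  ... | inj₂ carry | eq% rewrite carry | +-suc i (i / N) = %-shift-≢ 2 (diagonal i) N z<s 2<N eq%

  diagonal-% : ∀ i → i / N < N → diagonal i % N ≡ (i % N + i / N) % N
  diagonal-% i q<N = trans (%-distribˡ-+ i (i / N) N) (cong (λ q → (i % N + q) % N) (m<n⇒m%n≡m q<N))

  column-diagonal-injective : ∀ {i j} → i < N * N → j < N * N →
                              i % N ≡ j % N → diagonal i % N ≡ diagonal j % N → i ≡ j
  column-diagonal-injective {i} {j} i<N² j<N² column≡ diagonal≡ =
    %-/-injective i j N column≡ (%-cancelˡ-< (j % N) qᵢ<N qⱼ<N (begin
      (j % N + i / N) % N ≡⟨ cong (λ r → (r + i / N) % N) column≡ ⟨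
      (i % N + i / N) % N ≡⟨ diagonal-% i qᵢ<N ⟨
      diagonal i % N      ≡⟨ diagonal≡ ⟩
      diagonal j % N      ≡⟨ diagonal-% j qⱼ<N ⟩
      (j % N + j / N) % N ∎))
    where
    open ≡-Reasoning
    qᵢ<N : i / N < N
    qᵢ<N = m<n*o⇒m/o<n i<N²
    qⱼ<N : j / N < N
    qⱼ<N = m<n*o⇒m/o<n j<N²

  hasOrthColouring : ∀ {n} → 2 < N → n ≤ N * N → N ∤ n ∸ 1 → N ∤ diagonal (n ∸ 1) →
                     HasOrthColouring n N
  hasOrthColouring {n} 2<N n≤N² N∤n-1 N∤diagonal =
      columnColour ∘ toℕ
    , diagonalColour ∘ toℕ
    , sequence⇒properColouring columnColour (columnColour-step (<-trans (s≤s z<s) 2<N))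
        (∤⇒%≢0% (n ∸ 1) N N∤n-1 ∘ mod≡⇒%≡ (n ∸ 1) 0 N)
    , sequence⇒properColouring diagonalColour (diagonalColour-step 2<N)
        (λ eq → ∤⇒%≢0% (diagonal (n ∸ 1)) N N∤diagonal
                  (trans (mod≡⇒%≡ (diagonal (n ∸ 1)) (diagonal 0) N eq) (cong (_% N) (0/n≡0 N))))
    , λ {u} {v} eq → toℕ-injective (column-diagonal-injective
        (<-≤-trans (toℕ<n u) n≤N²) (<-≤-trans (toℕ<n v) n≤N²)
        (mod≡⇒%≡ (toℕ u) (toℕ v) N (cong proj₁ eq))
        (mod≡⇒%≡ (diagonal (toℕ u)) (diagonal (toℕ v)) N (cong proj₂ eq)))

4<m*m⇒2<m : ∀ m → 4 < m * m → 2 < m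
4<m*m⇒2<m m 4<m² = ≰⇒> λ m≤2 → <⇒≱ 4<m² (*-mono-≤ m≤2 m≤2)

lemma1 : (n N : ℕ) → 4 < n → IsCeilSqrt n N → .{{_ : NonZero N}} →
           N ∤ (n ∸ 1) → N ∤ ((n ∸ 1) + ((n ∸ 1) / N)) →
           OrthChromaticNumberIs n N
lemma1 n N 4<n ceilSqrt@(_ , n≤N²) N∤n-1 N∤diagonal =
    GridColouring.hasOrthColouring N (4<m*m⇒2<m N (<-≤-trans 4<n n≤N²)) n≤N² N∤n-1 N∤diagonal
  , λ k k<N → ¬orthColouring-<ceilSqrt ceilSqrt k<N
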